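{- Let $C\in\mathbb{R}^{n\times n}$ and let $H$ be a positive real. Assume that for every subset $K\subseteq\{1,\ldots,n\}$ and every cyclic permutation $\sigma$ of $K$, $$\sum_{\kappa\in K}C_{\kappa,\sigma(\kappa)}\geq |K|\max_{\kappa\in K}\{C_{\kappa\kappa}\}+H\sum_{\kappa\in K}\left|C_{\kappa\kappa}-C_{\sigma(\kappa)\sigma(\kappa)}\right|.$$ Then $C$ is similar to a diagonally $H$-dominant matrix.
   Context: For $s_1,\ldots,s_n\in\mathbb{R}$, a similarity transformation sends $C\in\mathbb{R}^{n\times n}$ to the matrix with $(i,j)$ entry $C_{ij}+s_i-s_j$; matrices are similar if one is sent to the other by such a transformation. For a positive real $H$, a matrix $A\in\mathbb{R}^{n\times n}$ is diagonally $H$-dominant if $A_{ij}\geq\max\{A_{ii},A_{jj}\}+H|A_{ii}-A_{jj}|$ for all $i,j$. -}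

module Defs where

open import Level using (0ℓ)
open import Data.Nat using (ℕ; zero; suc)
open import Data.Fin using (Fin)
open import Data.List using (List; []; _∷_; foldr; length)
open import Data.List.Membership.Propositional using (_∈_)
open import Data.List.Relation.Unary.Unique.Propositional using (Unique)
open import Data.Product using (Σ; ∃; _×_; _,_)
open import Data.Sum using (_⊎_; inj₁; inj₂)
open import Data.Empty using (⊥)
open import Relation.Nullary using (¬_)
open import Relation.Binary.PropositionalEquality using (_≡_)

-- The real numbers, axiomatised as a Dedekind-complete linearly ordered field
-- (unique up to isomorphism). Theorems are stated for every such model.
record RealField : Set₁ where
  infixl 6 _+_ _-_
  infixl 7 _*_
  infix  4 _≤_
  field
    ℝ     : Set
    _+_   : ℝ → ℝ → ℝ
    _*_   : ℝ → ℝ → ℝ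
    -_    : ℝ → ℝ
    0ℝ    : ℝ
    1ℝ    : ℝ
    _≤_   : ℝ → ℝ → Set
    +-assoc  : ∀ x y z → (x + y) + z ≡ x + (y + z)
    +-comm   : ∀ x y → x + y ≡ y + x
    +-identityˡ : ∀ x → 0ℝ + x ≡ x
    +-inverseˡ  : ∀ x → (- x) + x ≡ 0ℝ
    *-assoc  : ∀ x y z → (x * y) * z ≡ x * (y * z)
    *-comm   : ∀ x y → x * y ≡ y * x
    *-identityˡ : ∀ x → 1ℝ * x ≡ x
    distribˡ : ∀ x y z → x * (y + z) ≡ x * y + x * z
    0≢1      : ¬ (0ℝ ≡ 1ℝ)
    *-inverse : ∀ x → ¬ (x ≡ 0ℝ) → ∃ λ y → x * y ≡ 1ℝ
    ≤-refl    : ∀ x → x ≤ x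
    ≤-antisym : ∀ {x y} → x ≤ y → y ≤ x → x ≡ y
    ≤-trans   : ∀ {x y z} → x ≤ y → y ≤ z → x ≤ z
    ≤-total   : ∀ x y → (x ≤ y) ⊎ (y ≤ x)
    +-mono-≤  : ∀ {x y} z → x ≤ y → x + z ≤ y + z
    *-nonneg  : ∀ {x y} → 0ℝ ≤ x → 0ℝ ≤ y → 0ℝ ≤ x * y
    lub : (P : ℝ → Set) → (∃ λ x → P x) → (∃ λ b → ∀ x → P x → x ≤ b) →
          ∃ λ s → (∀ x → P x → x ≤ s) × (∀ b → (∀ x → P x → x ≤ b) → s ≤ b)

  _-_ : ℝ → ℝ → ℝ
  x - y = x + (- y)

  _<_ : ℝ → ℝ → Set
  x < y = (x ≤ y) × ¬ (x ≡ y)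

  max : ℝ → ℝ → ℝ
  max x y with ≤-total x y
  ... | inj₁ _ = y
  ... | inj₂ _ = x

  ∣_∣ : ℝ → ℝ
  ∣ x ∣ = max x (- x)

  _·_ : ℕ → ℝ → ℝ
  zero  · x = 0ℝ
  suc m · x = x + m · x

  -- Σ_{κ ∈ K} f κ, for a finite set K given as a duplicate-free list
  sumOver : {n : ℕ} → (Fin n → ℝ) → List (Fin n) → ℝ
  sumOver f K = foldr (λ κ acc → f κ + acc) 0ℝ K

  -- max_{κ ∈ K} f κ for the nonempty set K = k ∷ ks
  maxOver : {n : ℕ} → (Fin n → ℝ) → Fin n → List (Fin n) → ℝ
  maxOver f k ks = foldr (λ κ acc → max (f κ) acc) (f k) ks

Matrix : RealField → ℕ → Set
Matrix R n = Fin n → Fin n → RealField.ℝ R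

iter : {n : ℕ} → (Fin n → Fin n) → ℕ → Fin n → Fin n
iter σ zero    a = a
iter σ (suc m) a = σ (iter σ m a)

-- Values of σ outside K are irrelevant.
IsCyclicPermOf : {n : ℕ} → (Fin n → Fin n) → List (Fin n) → Set
IsCyclicPermOf σ K =
  (∀ {a} → a ∈ K → σ a ∈ K) ×
  (∀ {a b} → a ∈ K → b ∈ K → σ a ≡ σ b → a ≡ b) ×
  (∀ {a b} → a ∈ K → b ∈ K → ∃ λ m → iter σ m a ≡ b)

similarBy : (R : RealField) {n : ℕ} → (Fin n → RealField.ℝ R) → Matrix R n → Matrix R n
similarBy R s C i j = C i j + s i - s j
  where open RealField R

DiagDominant : (R : RealField) {n : ℕ} → RealField.ℝ R → Matrix R n → Set
DiagDominant R H A = ∀ i j → max (A i i) (A j j) + H * ∣ A i i - A j j ∣ ≤ A i j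
  where open RealField R

SimilarToDiagDominant : (R : RealField) {n : ℕ} → RealField.ℝ R → Matrix R n → Set
SimilarToDiagDominant R {n} H C =
  Σ (Fin n → RealField.ℝ R) λ s → DiagDominant R H (similarBy R s C)

module Submission where

-- Put  b(x, y) = max x y + H ∣x - y∣  and call
-- w i j = C i j - b(C i i, C j j)  the slack of the entry (i, j).  A similarity
-- transformation by s leaves the diagonal unchanged and adds s i - s j to the
-- entry (i, j), so the claim is that some potential s satisfies
-- s j ≤ w i j + s i  for all i, j: a shortest-path potential for the complete
-- digraph on Fin n weighted by w.  Such a potential exists once no closed walk
-- has negative weight; it is  s j = sup { - weight of a walk starting at j },
-- which exists by completeness of ℝ.

open import Defs
open import Level using (0ℓ)
open import Data.Nat using (ℕ; zero; suc; s≤s; z≤n)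
  renaming (_+_ to _+ℕ_; _≤_ to _≤ℕ_; _<_ to _<ℕ_)
import Data.Nat.Properties as ℕ
open import Data.Fin using (Fin; _≟_)
open import Data.List using (List; []; _∷_; _++_; _∷ʳ_; length; allFin)
open import Data.List.Properties
  using (++-assoc; ++-identityʳ; ++-conicalʳ; length-++; ∷-injectiveˡ; ∷-injectiveʳ; ∷ʳ-injectiveʳ)
open import Data.List.Membership.Propositional using (_∈_)
open import Data.List.Membership.Propositional.Properties using (∈-∃++; ∈-allFin; ∈-++⁺ʳ)
import Data.List.Membership.DecPropositional as DecMembership
open import Data.List.Relation.Unary.Any using (here; there)
open import Data.List.Relation.Unary.All as All using (All; []; _∷_)
open import Data.List.Relation.Unary.All.Properties using (¬Any⇒All¬)
open import Data.List.Relation.Unary.AllPairs using ([]; _∷_)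
open import Data.List.Relation.Unary.Unique.Propositional using (Unique)
open import Data.Product using (∃; _×_; _,_; proj₁; proj₂)
open import Data.Sum using (_⊎_; inj₁; inj₂)
open import Data.Empty using (⊥-elim)
open import Function using (case_of_)
open import Relation.Nullary using (¬_; yes; no)
open import Relation.Binary.Definitions using (DecidableEquality)
open import Relation.Binary.PropositionalEquality
open import Algebra.Bundles using (CommutativeMonoid)
import Algebra.Solver.CommutativeMonoid as CommutativeMonoidSolver

module RealFacts (R : RealField) where
  open RealField R public
  open ≡-Reasoning

  +-identityʳ : ∀ x → x + 0ℝ ≡ x
  +-identityʳ x = trans (+-comm x 0ℝ) (+-identityˡ x)

  +-inverseʳ : ∀ x → x - x ≡ 0ℝ
  +-inverseʳ x = trans (+-comm x (- x)) (+-inverseˡ x)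

  +-commutativeMonoid : CommutativeMonoid 0ℓ 0ℓ
  +-commutativeMonoid = record
    { isCommutativeMonoid = record
      { isMonoid = record
        { isSemigroup = record
          { isMagma = record { isEquivalence = isEquivalence ; ∙-cong = cong₂ _+_ }
          ; assoc = +-assoc }
        ; identity = +-identityˡ , +-identityʳ }
      ; comm = +-comm } }

  open CommutativeMonoidSolver +-commutativeMonoid using (solve; _⊜_; _⊕_)

  +-interchange : ∀ a b c d → (a + b) + (c + d) ≡ (a + c) + (b + d)
  +-interchange = solve 4 (λ a b c d → (a ⊕ b) ⊕ (c ⊕ d) ⊜ (a ⊕ c) ⊕ (b ⊕ d)) refl

  neg-unique : ∀ x y → x + y ≡ 0ℝ → y ≡ - x
  neg-unique x y x+y≡0 = begin
    y               ≡⟨ sym (+-identityˡ y) ⟩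
    0ℝ + y          ≡⟨ cong (_+ y) (sym (+-inverseˡ x)) ⟩
    (- x + x) + y   ≡⟨ +-assoc (- x) x y ⟩
    - x + (x + y)   ≡⟨ cong (- x +_) x+y≡0 ⟩
    - x + 0ℝ        ≡⟨ +-identityʳ (- x) ⟩
    - x             ∎

  neg-involutive : ∀ x → - (- x) ≡ x
  neg-involutive x = sym (neg-unique (- x) x (+-inverseˡ x))

  neg-zero : - 0ℝ ≡ 0ℝ
  neg-zero = sym (neg-unique 0ℝ 0ℝ (+-identityˡ 0ℝ))

  neg-distrib-+ : ∀ x y → - (x + y) ≡ - x + - y
  neg-distrib-+ x y = sym (neg-unique (x + y) (- x + - y) (begin
    (x + y) + (- x + - y)   ≡⟨ +-interchange x y (- x) (- y) ⟩
    (x - x) + (y - y)       ≡⟨ cong₂ _+_ (+-inverseʳ x) (+-inverseʳ y) ⟩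
    0ℝ + 0ℝ                 ≡⟨ +-identityˡ 0ℝ ⟩
    0ℝ                      ∎))

  +-cancel-neg : ∀ x y → x + y - y ≡ x
  +-cancel-neg x y = begin
    (x + y) - y     ≡⟨ +-assoc x y (- y) ⟩
    x + (y - y)     ≡⟨ cong (x +_) (+-inverseʳ y) ⟩
    x + 0ℝ          ≡⟨ +-identityʳ x ⟩
    x               ∎

  *-zeroʳ : ∀ x → x * 0ℝ ≡ 0ℝ
  *-zeroʳ x = sym (begin
    0ℝ              ≡⟨ sym (+-inverseʳ a) ⟩
    a - a           ≡⟨ cong (_- a) a≡a+a ⟩
    (a + a) - a     ≡⟨ +-cancel-neg a a ⟩
    a               ∎)
    where
    a : ℝ
    a = x * 0ℝ
    a≡a+a : a ≡ a + a
    a≡a+a = trans (cong (x *_) (sym (+-identityˡ 0ℝ))) (distribˡ x 0ℝ 0ℝ)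

  +-monoʳ-≤ : ∀ {x y} z → x ≤ y → z + x ≤ z + y
  +-monoʳ-≤ {x} {y} z x≤y = subst₂ _≤_ (+-comm x z) (+-comm y z) (+-mono-≤ z x≤y)

  +-mono₂-≤ : ∀ {a b c d} → a ≤ b → c ≤ d → a + c ≤ b + d
  +-mono₂-≤ {b = b} {c = c} a≤b c≤d = ≤-trans (+-mono-≤ c a≤b) (+-monoʳ-≤ b c≤d)

  +-nonneg : ∀ {a b} → 0ℝ ≤ a → 0ℝ ≤ b → 0ℝ ≤ a + b
  +-nonneg 0≤a 0≤b = subst (_≤ _) (+-identityˡ 0ℝ) (+-mono₂-≤ 0≤a 0≤b)

  ≤⇒diff-nonneg : ∀ {x y} → x ≤ y → 0ℝ ≤ y - x
  ≤⇒diff-nonneg {x} {y} x≤y = subst (_≤ y - x) (+-inverseʳ x) (+-mono-≤ (- x) x≤y)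

  diff-nonneg⇒≤ : ∀ {x y} → 0ℝ ≤ y - x → x ≤ y
  diff-nonneg⇒≤ {x} {y} 0≤y-x =
    subst₂ _≤_ (+-identityˡ x) add-back (+-mono-≤ x 0≤y-x)
    where
    add-back : (y - x) + x ≡ y
    add-back = trans (+-assoc y (- x) x) (trans (cong (y +_) (+-inverseˡ x)) (+-identityʳ y))

  neg-≤-of-nonneg-sum : ∀ a b → 0ℝ ≤ a + b → - a ≤ b
  neg-≤-of-nonneg-sum a b 0≤a+b =
    diff-nonneg⇒≤ (subst (0ℝ ≤_) (trans (+-comm a b) (cong (b +_) (sym (neg-involutive a)))) 0≤a+b)

  neg-≤-shift : ∀ b a u → - (b + a) ≤ u → - a ≤ b + u
  neg-≤-shift b a u -[b+a]≤u = subst₂ _≤_ cancel refl (+-monoʳ-≤ b (subst (_≤ u) (neg-distrib-+ b a) -[b+a]≤u))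
    where
    cancel : b + (- b + - a) ≡ - a
    cancel = trans (sym (+-assoc b (- b) (- a))) (trans (cong (_+ - a) (+-inverseʳ b)) (+-identityˡ (- a)))

  transpose-≤ : ∀ t s c e → t ≤ (c - e) + s → e ≤ (c + s) - t
  transpose-≤ t s c e t≤c-e+s =
    diff-nonneg⇒≤ (subst (0ℝ ≤_) (regroup s c (- e) (- t)) (≤⇒diff-nonneg t≤c-e+s))
    where
    regroup : ∀ s c e' t' → ((c + e') + s) + t' ≡ ((c + s) + t') + e'
    regroup = solve 4 (λ s c e' t' → ((c ⊕ e') ⊕ s) ⊕ t' ⊜ ((c ⊕ s) ⊕ t') ⊕ e') refl

  max-ubˡ : ∀ x y → x ≤ max x y
  max-ubˡ x y with ≤-total x y
  ... | inj₁ x≤y = x≤y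
  ... | inj₂ _   = ≤-refl x

  max-ubʳ : ∀ x y → y ≤ max x y
  max-ubʳ x y with ≤-total x y
  ... | inj₁ _   = ≤-refl y
  ... | inj₂ y≤x = y≤x

  max-lub : ∀ {x y m} → x ≤ m → y ≤ m → max x y ≤ m
  max-lub {x} {y} x≤m y≤m with ≤-total x y
  ... | inj₁ _ = y≤m
  ... | inj₂ _ = x≤m

  module _ {n : ℕ} where

    maxOver-ub : ∀ (f : Fin n → ℝ) k ks {κ} → κ ∈ k ∷ ks → f κ ≤ maxOver f k ks
    maxOver-ub f k []       (here refl)         = ≤-refl (f k)
    maxOver-ub f k (y ∷ ys) (here refl)         = ≤-trans (maxOver-ub f k ys (here refl)) (max-ubʳ (f y) _)
    maxOver-ub f k (y ∷ ys) (there (here refl)) = max-ubˡ (f y) _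
    maxOver-ub f k (y ∷ ys) (there (there κ∈))  = ≤-trans (maxOver-ub f k ys (there κ∈)) (max-ubʳ (f y) _)

    sumOver-+ : ∀ (f g : Fin n → ℝ) L → sumOver (λ κ → f κ + g κ) L ≡ sumOver f L + sumOver g L
    sumOver-+ f g []      = sym (+-identityˡ 0ℝ)
    sumOver-+ f g (x ∷ L) = trans (cong (f x + g x +_) (sumOver-+ f g L)) (+-interchange (f x) (g x) _ _)

    sumOver-neg : ∀ (f : Fin n → ℝ) L → sumOver (λ κ → - f κ) L ≡ - sumOver f L
    sumOver-neg f []      = sym neg-zero
    sumOver-neg f (x ∷ L) = trans (cong (- f x +_) (sumOver-neg f L)) (sym (neg-distrib-+ (f x) _))

    sumOver-scale : ∀ h (f : Fin n → ℝ) L → sumOver (λ κ → h * f κ) L ≡ h * sumOver f L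
    sumOver-scale h f []      = sym (*-zeroʳ h)
    sumOver-scale h f (x ∷ L) = trans (cong (h * f x +_) (sumOver-scale h f L)) (sym (distribˡ h (f x) _))

    sumOver-const : ∀ c (L : List (Fin n)) → sumOver (λ _ → c) L ≡ length L · c
    sumOver-const c []      = refl
    sumOver-const c (x ∷ L) = cong (c +_) (sumOver-const c L)

    sumOver-mono : ∀ (f g : Fin n → ℝ) L → (∀ {κ} → κ ∈ L → f κ ≤ g κ) → sumOver f L ≤ sumOver g L
    sumOver-mono f g []      f≤g = ≤-refl 0ℝ
    sumOver-mono f g (x ∷ L) f≤g = +-mono₂-≤ (f≤g (here refl)) (sumOver-mono f g L (λ κ∈ → f≤g (there κ∈)))

    sumOver-cong : ∀ (f g : Fin n → ℝ) {L} → All (λ κ → f κ ≡ g κ) L → sumOver f L ≡ sumOver g L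
    sumOver-cong f g []         = refl
    sumOver-cong f g (fx≡gx ∷ e) = cong₂ _+_ fx≡gx (sumOver-cong f g e)

module DuplicateFree {X : Set} where

  split-shift : ∀ P (x : X) Q → P ++ x ∷ Q ≡ (P ∷ʳ x) ++ Q
  split-shift P x Q = sym (++-assoc P (x ∷ []) Q)

  head-not-repeated : ∀ {z : X} {S} P {S'} → All (z ≢_) S → ¬ S ≡ P ++ z ∷ S'
  head-not-repeated P z∉S S≡ = All.lookup z∉S (subst (_ ∈_) (sym S≡) (∈-++⁺ʳ P (here refl))) refl

  position-unique : ∀ {M : List X} {z S S'} P P' → Unique M →
                    M ≡ P ++ z ∷ S → M ≡ P' ++ z ∷ S' → P ≡ P'
  position-unique []      []       _         _    _    = refl
  position-unique []      (p ∷ P') (z∉S ∷ _) refl M≡   = ⊥-elim (head-not-repeated P' z∉S (∷-injectiveʳ M≡))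
  position-unique (p ∷ P) []       (z∉S ∷ _) M≡   refl = ⊥-elim (head-not-repeated P z∉S (∷-injectiveʳ M≡))
  position-unique (p ∷ P) (p' ∷ P') (_ ∷ u)  refl M≡   =
    cong₂ _∷_ (∷-injectiveˡ M≡) (position-unique P P' u refl (∷-injectiveʳ M≡))

  Repetition : List X → Set
  Repetition M = ∃ λ A → ∃ λ x → ∃ λ B → ∃ λ D → M ≡ A ++ x ∷ B ++ x ∷ D

  module _ (_≟ₓ_ : DecidableEquality X) where
    open DecMembership _≟ₓ_ using (_∈?_)

    unique-or-repetition : ∀ M → Unique M ⊎ Repetition M
    unique-or-repetition [] = inj₁ []
    unique-or-repetition (y ∷ r) with y ∈? r
    ... | yes y∈r with ∈-∃++ y∈r
    ...   | B , D , r≡ = inj₂ ([] , y , B , D , cong (y ∷_) r≡)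
    unique-or-repetition (y ∷ r) | no y∉r with unique-or-repetition r
    ...   | inj₁ u                     = inj₁ (¬Any⇒All¬ r y∉r ∷ u)
    ...   | inj₂ (A , x , B , D , r≡) = inj₂ (y ∷ A , x , B , D , cong (y ∷_) r≡)

  cycle-shorter : ∀ A (x : X) B D → length (x ∷ B) <ℕ length (A ++ x ∷ B ++ x ∷ D)
  cycle-shorter []      x B D = s≤s (subst (length B <ℕ_) (sym (length-++ B)) (ℕ.m<m+n (length B) (s≤s z≤n)))
  cycle-shorter (a ∷ A) x B D = ℕ.m<n⇒m<1+n (cycle-shorter A x B D)

  rest-shorter : ∀ A (x : X) B D → length (A ++ x ∷ D) <ℕ length (A ++ x ∷ B ++ x ∷ D)
  rest-shorter []      x B D = s≤s (subst (suc (length D) ≤ℕ_) (sym (length-++ B)) (ℕ.m≤n+m (suc (length D)) (length B)))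
  rest-shorter (a ∷ A) x B D = s≤s (rest-shorter A x B D)

module CyclicSuccessor {n : ℕ} where
  open DuplicateFree
  open ≡-Reasoning

  headOr : Fin n → List (Fin n) → Fin n
  headOr f []      = f
  headOr f (z ∷ _) = z

  next : Fin n → List (Fin n) → Fin n → Fin n
  next f []      x = f
  next f (y ∷ r) x with x ≟ y
  ... | yes _ = headOr f r
  ... | no  _ = next f r x

  next-head : ∀ f y r → next f (y ∷ r) y ≡ headOr f r
  next-head f y r with y ≟ y
  ... | yes _  = refl
  ... | no y≢y = ⊥-elim (y≢y refl)

  next-skip : ∀ f {y} r {x} → x ≢ y → next f (y ∷ r) x ≡ next f r x
  next-skip f {y} r {x} x≢y with x ≟ y
  ... | yes x≡y = ⊥-elim (x≢y x≡y)
  ... | no  _   = refl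

  next-at : ∀ f {M x Q} P → Unique M → M ≡ P ++ x ∷ Q → next f M x ≡ headOr f Q
  next-at f {x = x} {Q} []      _         refl = next-head f x Q
  next-at f {x = x} {Q} (p ∷ P) (p∉ ∷ u) refl =
    trans (next-skip f (P ++ x ∷ Q) x≢p) (next-at f P u refl)
    where
    x≢p : x ≢ p
    x≢p x≡p = All.lookup p∉ (∈-++⁺ʳ P (here refl)) (sym x≡p)

  iter-shift : ∀ (σ : Fin n → Fin n) m x → iter σ (suc m) x ≡ iter σ m (σ x)
  iter-shift σ zero    x = refl
  iter-shift σ (suc m) x = cong σ (iter-shift σ m x)

  iter-+ : ∀ (σ : Fin n → Fin n) m k x → iter σ (m +ℕ k) x ≡ iter σ m (iter σ k x)
  iter-+ σ zero    k x = refl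
  iter-+ σ (suc m) k x = cong σ (iter-+ σ m k x)

  module OfList (a : Fin n) (L : List (Fin n)) (unique : Unique (a ∷ L)) where
    K : List (Fin n)
    K = a ∷ L

    σ : Fin n → Fin n
    σ = next a K

    step : ∀ {P x Q} → K ≡ P ++ x ∷ Q → σ x ≡ headOr a Q
    step {P} = next-at a P unique

    advance : ∀ {P x Q} S T → K ≡ P ++ x ∷ Q → Q ≡ S ++ T → iter σ (suc (length S)) x ≡ headOr a T
    advance [] T K≡ refl = step K≡
    advance {P} {x} (y ∷ S) T K≡ refl = begin
      iter σ (suc (suc (length S))) x   ≡⟨ iter-shift σ (suc (length S)) x ⟩
      iter σ (suc (length S)) (σ x)     ≡⟨ cong (iter σ (suc (length S))) (step K≡) ⟩
      iter σ (suc (length S)) y         ≡⟨ advance S T (trans K≡ (split-shift P x _)) refl ⟩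
      headOr a T                        ∎

    returns-to-head : ∀ {x} → x ∈ K → ∃ λ m → iter σ m x ≡ a
    returns-to-head x∈K with ∈-∃++ x∈K
    ... | P , Q , K≡ = suc (length Q) , advance Q [] K≡ (sym (++-identityʳ Q))

    reached-from-head : ∀ {x} → x ∈ K → ∃ λ m → iter σ m a ≡ x
    reached-from-head (here refl)  = 0 , refl
    reached-from-head (there x∈L) with ∈-∃++ x∈L
    ... | S , T , L≡ = suc (length S) , advance {P = []} S (_ ∷ T) refl L≡

    transitive : ∀ {x y} → x ∈ K → y ∈ K → ∃ λ m → iter σ m x ≡ y
    transitive {x} x∈K y∈K with returns-to-head x∈K | reached-from-head y∈K
    ... | k , x↦a | m , a↦y = m +ℕ k , trans (iter-+ σ m k x) (trans (cong (iter σ m) x↦a) a↦y)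

    maps-into : ∀ {x} → x ∈ K → σ x ∈ K
    maps-into x∈K with ∈-∃++ x∈K
    ... | P , Q , K≡ = subst (_∈ K) (sym (step K≡)) (headOr-∈ Q K≡)
      where
      headOr-∈ : ∀ {x} Q → K ≡ P ++ x ∷ Q → headOr a Q ∈ K
      headOr-∈ []      _  = here refl
      headOr-∈ (z ∷ _) K≡ = subst (z ∈_) (sym K≡) (∈-++⁺ʳ P (there (here refl)))

    head-not-later : ∀ {P x Q} → ¬ K ≡ P ++ x ∷ a ∷ Q
    head-not-later {P} {x} K≡ =
      case ++-conicalʳ P (x ∷ []) (sym (position-unique [] (P ∷ʳ x) unique refl (trans K≡ (split-shift P x _))))
      of λ ()

    same-successor : ∀ {P P' x y} Q Q' → K ≡ P ++ x ∷ Q → K ≡ P' ++ y ∷ Q' →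
                     headOr a Q ≡ headOr a Q' → x ≡ y
    same-successor {P} {P'} [] [] K≡ K≡' _ = ∷ʳ-injectiveʳ P P' (trans (sym K≡) K≡')
    same-successor {P} {P'} {x} {y} (z ∷ Q) (_ ∷ Q') K≡ K≡' refl =
      ∷ʳ-injectiveʳ P P' (position-unique (P ∷ʳ x) (P' ∷ʳ y) unique
        (trans K≡ (split-shift P x _)) (trans K≡' (split-shift P' y _)))
    same-successor (_ ∷ _) []      K≡ _   refl = ⊥-elim (head-not-later K≡)
    same-successor []      (_ ∷ _) _  K≡' refl = ⊥-elim (head-not-later K≡')

    injective : ∀ {x y} → x ∈ K → y ∈ K → σ x ≡ σ y → x ≡ y
    injective x∈K y∈K σx≡σy with ∈-∃++ x∈K | ∈-∃++ y∈K
    ... | P , Q , K≡ | P' , Q' , K≡' =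
      same-successor Q Q' K≡ K≡' (trans (sym (step K≡)) (trans σx≡σy (step K≡')))

    isCyclicPerm : IsCyclicPermOf σ K
    isCyclicPerm = maps-into , injective , transitive

module Walks (R : RealField) {n : ℕ} (w : Fin n → Fin n → RealField.ℝ R) where
  open RealFacts R
  open DuplicateFree
  open CyclicSuccessor
  open ≡-Reasoning

  pathWeight : List (Fin n) → ℝ
  pathWeight []            = 0ℝ
  pathWeight (x ∷ [])      = 0ℝ
  pathWeight (x ∷ y ∷ r)   = w x y + pathWeight (y ∷ r)

  cycleWeight : List (Fin n) → ℝ
  cycleWeight []      = 0ℝ
  cycleWeight (a ∷ L) = pathWeight (a ∷ L ++ a ∷ [])

  pathWeight-split : ∀ P x Q → pathWeight (P ++ x ∷ Q) ≡ pathWeight (P ∷ʳ x) + pathWeight (x ∷ Q)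
  pathWeight-split []          x Q = sym (+-identityˡ _)
  pathWeight-split (p ∷ [])    x Q = cong (_+ pathWeight (x ∷ Q)) (sym (+-identityʳ (w p x)))
  pathWeight-split (p ∷ q ∷ P) x Q =
    trans (cong (w p q +_) (pathWeight-split (q ∷ P) x Q)) (sym (+-assoc _ _ _))

  lastOf : Fin n → List (Fin n) → Fin n
  lastOf x []       = x
  lastOf x (v ∷ vs) = lastOf v vs

  pathWeight-snoc : ∀ x vs y → pathWeight (x ∷ vs ∷ʳ y) ≡ pathWeight (x ∷ vs) + w (lastOf x vs) y
  pathWeight-snoc x []       y = trans (+-identityʳ (w x y)) (sym (+-identityˡ _))
  pathWeight-snoc x (v ∷ vs) y = trans (cong (w x v +_) (pathWeight-snoc v vs y)) (sym (+-assoc _ _ _))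

  excise : ∀ P x B Q → pathWeight (P ++ x ∷ B ++ x ∷ Q) ≡ cycleWeight (x ∷ B) + pathWeight (P ++ x ∷ Q)
  excise P x B Q = begin
    pathWeight (P ++ x ∷ B ++ x ∷ Q)
      ≡⟨ pathWeight-split P x (B ++ x ∷ Q) ⟩
    pathWeight (P ∷ʳ x) + pathWeight ((x ∷ B) ++ x ∷ Q)
      ≡⟨ cong (pathWeight (P ∷ʳ x) +_) (pathWeight-split (x ∷ B) x Q) ⟩
    pathWeight (P ∷ʳ x) + (cycleWeight (x ∷ B) + pathWeight (x ∷ Q))
      ≡⟨ sym (+-assoc _ _ _) ⟩
    (pathWeight (P ∷ʳ x) + cycleWeight (x ∷ B)) + pathWeight (x ∷ Q)
      ≡⟨ cong (_+ pathWeight (x ∷ Q)) (+-comm _ _) ⟩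
    (cycleWeight (x ∷ B) + pathWeight (P ∷ʳ x)) + pathWeight (x ∷ Q)
      ≡⟨ +-assoc _ _ _ ⟩
    cycleWeight (x ∷ B) + (pathWeight (P ∷ʳ x) + pathWeight (x ∷ Q))
      ≡⟨ cong (cycleWeight (x ∷ B) +_) (sym (pathWeight-split P x Q)) ⟩
    cycleWeight (x ∷ B) + pathWeight (P ++ x ∷ Q)
      ∎

  cycleWeight-excise : ∀ A x B D →
    cycleWeight (A ++ x ∷ B ++ x ∷ D) ≡ cycleWeight (x ∷ B) + cycleWeight (A ++ x ∷ D)
  cycleWeight-excise [] x B D =
    trans (cong (λ T → pathWeight (x ∷ T)) (++-assoc B (x ∷ D) (x ∷ [])))
          (excise [] x B (D ∷ʳ x))
  cycleWeight-excise (a ∷ A) x B D = begin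
    pathWeight (a ∷ (A ++ x ∷ B ++ x ∷ D) ∷ʳ a)
      ≡⟨ cong (λ T → pathWeight (a ∷ T)) (++-assoc A (x ∷ B ++ x ∷ D) (a ∷ [])) ⟩
    pathWeight (a ∷ A ++ x ∷ (B ++ x ∷ D) ++ a ∷ [])
      ≡⟨ cong (λ T → pathWeight (a ∷ A ++ x ∷ T)) (++-assoc B (x ∷ D) (a ∷ [])) ⟩
    pathWeight ((a ∷ A) ++ x ∷ B ++ x ∷ (D ∷ʳ a))
      ≡⟨ excise (a ∷ A) x B (D ∷ʳ a) ⟩
    cycleWeight (x ∷ B) + pathWeight (a ∷ A ++ x ∷ D ∷ʳ a)
      ≡⟨ cong (λ T → cycleWeight (x ∷ B) + pathWeight (a ∷ T)) (sym (++-assoc A (x ∷ D) (a ∷ []))) ⟩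
    cycleWeight (x ∷ B) + cycleWeight (a ∷ A ++ x ∷ D)
      ∎

  sum-along-cycle : ∀ f M → Unique M → sumOver (λ κ → w κ (next f M κ)) M ≡ pathWeight (M ∷ʳ f)
  sum-along-cycle f []      _        = refl
  sum-along-cycle f (y ∷ r) (y∉ ∷ u) = begin
    w y (next f (y ∷ r) y) + sumOver (λ κ → w κ (next f (y ∷ r) κ)) r
      ≡⟨ cong₂ _+_ (cong (w y) (next-head f y r)) (sumOver-cong _ _ (All.map skip y∉)) ⟩
    w y (headOr f r) + sumOver (λ κ → w κ (next f r κ)) r
      ≡⟨ cong (w y (headOr f r) +_) (sum-along-cycle f r u) ⟩
    w y (headOr f r) + pathWeight (r ∷ʳ f)
      ≡⟨ first-edge r ⟩
    pathWeight (y ∷ r ∷ʳ f)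
      ∎
    where
    skip : ∀ {κ} → y ≢ κ → w κ (next f (y ∷ r) κ) ≡ w κ (next f r κ)
    skip y≢κ = cong (w _) (next-skip f r (λ κ≡y → y≢κ (sym κ≡y)))
    first-edge : ∀ r → w y (headOr f r) + pathWeight (r ∷ʳ f) ≡ pathWeight (y ∷ r ∷ʳ f)
    first-edge []      = refl
    first-edge (_ ∷ _) = refl

  SimpleCyclesNonneg : Set
  SimpleCyclesNonneg = ∀ M → Unique M → 0ℝ ≤ cycleWeight M

  -- If no simple cycle is negative, no closed walk is: split off cycles at
  -- repeated vertices (induction on the length of the walk).
  closedWalks-nonneg : SimpleCyclesNonneg → ∀ M → 0ℝ ≤ cycleWeight M
  closedWalks-nonneg simple M = bounded (suc (length M)) M (ℕ.n<1+n (length M))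
    where
    bounded : ∀ fuel M → length M <ℕ fuel → 0ℝ ≤ cycleWeight M
    bounded zero       M ()
    bounded (suc fuel) M M<fuel with unique-or-repetition _≟_ M
    ... | inj₁ u = simple M u
    ... | inj₂ (A , x , B , D , refl) =
      subst (0ℝ ≤_) (sym (cycleWeight-excise A x B D))
        (+-nonneg (bounded fuel (x ∷ B) (shorter (cycle-shorter A x B D)))
                  (bounded fuel (A ++ x ∷ D) (shorter (rest-shorter A x B D))))
      where
      shorter : ∀ {k} → k <ℕ length (A ++ x ∷ B ++ x ∷ D) → k <ℕ fuel
      shorter k<M = ℕ.<-≤-trans k<M (ℕ.≤-pred M<fuel)

  -- Without negative closed walks there is a feasible potential U, namely
  -- U j = sup { - weight of a walk starting at j }.
  potential : (∀ M → 0ℝ ≤ cycleWeight M) → ∃ λ U → ∀ i j → U j ≤ w i j + U i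
  potential closed = U , feasible
    where
    Reachable : Fin n → ℝ → Set
    Reachable j v = ∃ λ vs → v ≡ - pathWeight (j ∷ vs)

    bound : Fin n → ℝ
    bound j = maxOver (λ b → w b j) j (allFin n)

    -- Closing a walk from j with one edge back to j gives a nonnegative cycle,
    -- so minus the walk's weight is at most the weight of that last edge.
    bounded : ∀ j v → Reachable j v → v ≤ bound j
    bounded j _ (vs , refl) = ≤-trans
      (neg-≤-of-nonneg-sum _ _ (subst (0ℝ ≤_) (pathWeight-snoc j vs j) (closed (j ∷ vs))))
      (maxOver-ub (λ b → w b j) j (allFin n) (there (∈-allFin _)))

    supremum : ∀ j → ∃ λ s → (∀ v → Reachable j v → v ≤ s) × (∀ b → (∀ v → Reachable j v → v ≤ b) → s ≤ b)
    supremum j = lub (Reachable j) (- pathWeight (j ∷ []) , [] , refl) (bound j , bounded j)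

    U : Fin n → ℝ
    U j = proj₁ (supremum j)

    -- Prefixing the edge i → j to a walk from j gives a walk from i.
    feasible : ∀ i j → U j ≤ w i j + U i
    feasible i j = proj₂ (proj₂ (supremum j)) (w i j + U i) λ { _ (vs , refl) →
      neg-≤-shift (w i j) (pathWeight (j ∷ vs)) (U i) (proj₁ (proj₂ (supremum i)) _ (j ∷ vs , refl)) }

module Slack (R : RealField) {n : ℕ} (C : Matrix R n) (H : RealField.ℝ R) where
  open RealFacts R
  open CyclicSuccessor
  open ≡-Reasoning

  threshold : ℝ → ℝ → ℝ
  threshold x y = max x y + H * ∣ x - y ∣

  slack : Fin n → Fin n → ℝ
  slack i j = C i j - threshold (C i i) (C j j)

  open Walks R slack public

  CycleCondition : Set
  CycleCondition = ∀ (k : Fin n) (ks : List (Fin n)) (σ : Fin n → Fin n) →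
    Unique (k ∷ ks) → IsCyclicPermOf σ (k ∷ ks) →
    length (k ∷ ks) · maxOver (λ κ → C κ κ) k ks
      + H * sumOver (λ κ → ∣ C κ κ - C (σ κ) (σ κ) ∣) (k ∷ ks)
      ≤ sumOver (λ κ → C κ (σ κ)) (k ∷ ks)

  -- For σ mapping K = k ∷ ks into itself, the cycle inequality makes the total
  -- slack along σ nonnegative: each max (C κ κ) (C σκ σκ) is at most the max over K.
  slack-along-nonneg : ∀ k ks (σ : Fin n → Fin n) → (∀ {x} → x ∈ k ∷ ks → σ x ∈ k ∷ ks) →
    length (k ∷ ks) · maxOver (λ κ → C κ κ) k ks
      + H * sumOver (λ κ → ∣ C κ κ - C (σ κ) (σ κ) ∣) (k ∷ ks)
      ≤ sumOver (λ κ → C κ (σ κ)) (k ∷ ks) →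
    0ℝ ≤ sumOver (λ κ → slack κ (σ κ)) (k ∷ ks)
  slack-along-nonneg k ks σ into inequality =
    subst (0ℝ ≤_) (sym total-slack) (≤⇒diff-nonneg (≤-trans (+-mono-≤ _ maxima-bounded) inequality))
    where
    K : List (Fin n)
    K = k ∷ ks
    larger : Fin n → ℝ
    larger κ = max (C κ κ) (C (σ κ) (σ κ))
    gap : Fin n → ℝ
    gap κ = ∣ C κ κ - C (σ κ) (σ κ) ∣

    maxima-bounded : sumOver larger K ≤ length K · maxOver (λ κ → C κ κ) k ks
    maxima-bounded = subst (sumOver larger K ≤_) (sumOver-const _ K)
      (sumOver-mono larger _ K (λ κ∈K → max-lub (maxOver-ub _ k ks κ∈K) (maxOver-ub _ k ks (into κ∈K))))

    total-slack : sumOver (λ κ → slack κ (σ κ)) K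
                ≡ sumOver (λ κ → C κ (σ κ)) K - (sumOver larger K + H * sumOver gap K)
    total-slack = begin
      sumOver (λ κ → slack κ (σ κ)) K
        ≡⟨ sumOver-+ (λ κ → C κ (σ κ)) (λ κ → - threshold (C κ κ) (C (σ κ) (σ κ))) K ⟩
      sumOver (λ κ → C κ (σ κ)) K + sumOver (λ κ → - threshold (C κ κ) (C (σ κ) (σ κ))) K
        ≡⟨ cong (_ +_) (sumOver-neg (λ κ → threshold (C κ κ) (C (σ κ) (σ κ))) K) ⟩
      sumOver (λ κ → C κ (σ κ)) K - sumOver (λ κ → larger κ + H * gap κ) K
        ≡⟨ cong (λ t → sumOver (λ κ → C κ (σ κ)) K - t) (sumOver-+ larger (λ κ → H * gap κ) K) ⟩
      sumOver (λ κ → C κ (σ κ)) K - (sumOver larger K + sumOver (λ κ → H * gap κ) K)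
        ≡⟨ cong (λ t → sumOver (λ κ → C κ (σ κ)) K - (sumOver larger K + t)) (sumOver-scale H gap K) ⟩
      sumOver (λ κ → C κ (σ κ)) K - (sumOver larger K + H * sumOver gap K)
        ∎

  -- Under the cycle condition every simple cycle has nonnegative slack: realise
  -- it as the cyclic successor permutation of its vertex list.
  simpleCycles-nonneg : CycleCondition → SimpleCyclesNonneg
  simpleCycles-nonneg condition []      _      = ≤-refl 0ℝ
  simpleCycles-nonneg condition (a ∷ L) unique =
    subst (0ℝ ≤_) (sum-along-cycle a (a ∷ L) unique)
      (slack-along-nonneg a L σ maps-into (condition a L σ unique isCyclicPerm))
    where open OfList a L unique

  -- A potential that is feasible for the slack weights produces dominance,
  -- since the similarity transformation fixes the diagonal.
  feasible⇒dominant : ∀ (U : Fin n → ℝ) → (∀ i j → U j ≤ slack i j + U i) →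
                      DiagDominant R H (similarBy R U C)
  feasible⇒dominant U feasible i j =
    subst (_≤ similarBy R U C i j)
      (cong₂ threshold (sym (+-cancel-neg (C i i) (U i))) (sym (+-cancel-neg (C j j) (U j))))
      (transpose-≤ (U j) (U i) (C i j) (threshold (C i i) (C j j)) (feasible i j))

mainTheorem8 : (R : RealField) → let open RealField R in
    (n : ℕ) (C : Matrix R n) (H : ℝ) → 0ℝ < H →
    (∀ (k : Fin n) (ks : List (Fin n)) (σ : Fin n → Fin n) →
      Unique (k ∷ ks) → IsCyclicPermOf σ (k ∷ ks) →
      length (k ∷ ks) · maxOver (λ κ → C κ κ) k ks
        + H * sumOver (λ κ → ∣ C κ κ - C (σ κ) (σ κ) ∣) (k ∷ ks)
        ≤ sumOver (λ κ → C κ (σ κ)) (k ∷ ks)) →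
    SimilarToDiagDominant R H C
mainTheorem8 R n C H _ condition = U , feasible⇒dominant U feasible
  where
  open RealField R
  open Slack R C H
  -- Simple cycles, hence all closed walks, have nonnegative slack, so the
  -- slack digraph has a feasible potential U; shifting by U gives dominance.
  shifts : ∃ λ (U : Fin n → ℝ) → ∀ i j → U j ≤ slack i j + U i
  shifts = potential (closedWalks-nonneg (simpleCycles-nonneg condition))

  U : Fin n → ℝ
  U = proj₁ shifts

  feasible : ∀ i j → U j ≤ slack i j + U i
  feasible = proj₂ shifts
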